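{- Let $\mathbf{A}$ be an $\mathcal{L}$-lattice, $W$ a set, and $\mathbf{B}$ a subalgebra of $\mathbf{A}^W$ such that for each $f\in B$ the elements $\bigwedge_{v\in W}f(v)$ and $\bigvee_{v\in W}f(v)$ exist in $\mathbf{A}$ and the constant functions $$\Box f\colon W\to A;\ u\mapsto \bigwedge_{v\in W}f(v)\qquad\text{and}\qquad \Diamond f\colon W\to A;\ u\mapsto\bigvee_{v\in W}f(v)$$ belong to $B$. Then $\langle\mathbf{B},\Box,\Diamond\rangle$ is an m-$\mathcal{L}$-lattice. Moreover, if $\mathbf{A}$ belongs to a class $\mathsf{K}$ of $\mathcal{L}$-lattices closed under taking subalgebras and direct powers, then $\langle\mathbf{B},\Box,\Diamond\rangle\in\mathsf{mK}$.
   Context: $\mathcal{L}$ is a lattice-oriented signature: an algebraic signature (with $\mathcal{L}_n$ its $n$-ary operation symbols) containing distinct binary symbols $\land,\lor$. An $\mathcal{L}$-lattice is an algebra of signature $\mathcal{L}$ whose $\{\land,\lor\}$-reduct is a lattice (order $a\le b$ iff $a\land b=a$). For an $\mathcal{L}$-lattice $\mathbf{A}$ and set $W$, $\mathbf{A}^W$ is the $\mathcal{L}$-lattice on $A^W$ with pointwise operations. An m-lattice is an algebra $\langle L,\land,\lor,\Box,\Diamond\rangle$ with lattice reduct satisfying $\Box x\land x\approx \Box x$, $\Box(x\land y)\approx\Box x\land\Box y$, $\Box\Diamond x\approx\Diamond x$, $\Diamond x\lor x\approx\Diamond x$, $\Diamond(x\lor y)\approx\Diamond x\lor\Diamond y$,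 $\Diamond\Box x\approx\Box x$. An m-$\mathcal{L}$-lattice is $\langle\mathbf{A},\Box,\Diamond\rangle$ with $\mathbf{A}$ an $\mathcal{L}$-lattice, $\langle A,\land,\lor,\Box,\Diamond\rangle$ an m-lattice, and $\Box(\star(\Box x_1,\dots,\Box x_n))\approx\star(\Box x_1,\dots,\Box x_n)$ for every $n$ and $\star\in\mathcal{L}_n$. For a class $\mathsf{K}$ of $\mathcal{L}$-lattices, $\mathsf{mK}$ is the class of m-$\mathcal{L}$-lattices whose $\mathcal{L}$-lattice reduct is in $\mathsf{K}$. -}

module Defs where

open import Level using (Level; _⊔_) renaming (suc to lsuc)
open import Data.Nat using (ℕ)
open import Data.Fin using (Fin)
open import Data.Vec.Functional using (Vector; _∷_; [])
open import Data.Product using (Σ; _,_; proj₁; proj₂; _×_)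
open import Relation.Binary using (Rel; IsEquivalence)
open import Relation.Unary using (Pred; _∈_)
open import Relation.Nullary using (¬_)
open import Relation.Binary.PropositionalEquality using (_≡_)
open import Algebra.Lattice.Structures using (IsLattice)

record Signature : Set₁ where
  field
    Op        : ℕ → Set
    meet join : Op 2
    meet≢join : ¬ (meet ≡ join)

record IsMLattice {a ℓ} {C : Set a} (_≈_ : Rel C ℓ) (_∧_ _∨_ : C → C → C)
                  (□ ◇ : C → C) : Set (a ⊔ ℓ) where
  field
    isLattice : IsLattice _≈_ _∨_ _∧_
    □-cong    : ∀ {x y} → x ≈ y → □ x ≈ □ y
    ◇-cong    : ∀ {x y} → x ≈ y → ◇ x ≈ ◇ y
    □-∧-x     : ∀ x → (□ x ∧ x) ≈ □ x
    □-∧       : ∀ x y → □ (x ∧ y) ≈ (□ x ∧ □ y)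
    □◇        : ∀ x → □ (◇ x) ≈ ◇ x
    ◇-∨-x     : ∀ x → (◇ x ∨ x) ≈ ◇ x
    ◇-∨       : ∀ x y → ◇ (x ∨ y) ≈ (◇ x ∨ ◇ y)
    ◇□        : ∀ x → ◇ (□ x) ≈ □ x

module _ (𝓛 : Signature) where
  open Signature 𝓛

  record Algebra (a : Level) : Set (lsuc a) where
    field
      Carrier       : Set a
      _≈_           : Rel Carrier a
      isEquivalence : IsEquivalence _≈_
      ⟦_⟧           : ∀ {n} → Op n → Vector Carrier n → Carrier
      ⟦⟧-cong       : ∀ {n} (o : Op n) {xs ys : Vector Carrier n} →
                      (∀ i → xs i ≈ ys i) → ⟦ o ⟧ xs ≈ ⟦ o ⟧ ys

    infixr 7 _∧_
    infixr 6 _∨_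
    _∧_ : Carrier → Carrier → Carrier
    x ∧ y = ⟦ meet ⟧ (x ∷ y ∷ [])
    _∨_ : Carrier → Carrier → Carrier
    x ∨ y = ⟦ join ⟧ (x ∷ y ∷ [])

    _≤_ : Rel Carrier a
    x ≤ y = (x ∧ y) ≈ x

  open Algebra

  IsLLattice : ∀ {a} → Algebra a → Set a
  IsLLattice A = IsLattice (_≈_ A) (_∨_ A) (_∧_ A)

  Pow : ∀ {a} → Algebra a → Set a → Algebra a
  Pow A W = record
    { Carrier       = W → Carrier A
    ; _≈_           = λ f g → ∀ w → _≈_ A (f w) (g w)
    ; isEquivalence = record
        { refl  = λ w → IsEquivalence.refl (isEquivalence A)
        ; sym   = λ p w → IsEquivalence.sym (isEquivalence A) (p w)
        ; trans = λ p q w → IsEquivalence.trans (isEquivalence A) (p w) (q w)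
        }
    ; ⟦_⟧           = λ o fs w → ⟦_⟧ A o (λ i → fs i w)
    ; ⟦⟧-cong       = λ o ps w → ⟦⟧-cong A o (λ i → ps i w)
    }

  IsSubuniverse : ∀ {a} (A : Algebra a) → Pred (Carrier A) a → Set a
  IsSubuniverse A S = ∀ {n} (o : Op n) (xs : Vector (Carrier A) n) →
                      (∀ i → xs i ∈ S) → ⟦_⟧ A o xs ∈ S

  Sub : ∀ {a} (A : Algebra a) (S : Pred (Carrier A) a) → IsSubuniverse A S → Algebra a
  Sub A S closed = record
    { Carrier       = Σ (Carrier A) S
    ; _≈_           = λ x y → _≈_ A (proj₁ x) (proj₁ y)
    ; isEquivalence = record
        { refl  = IsEquivalence.refl (isEquivalence A)
        ; sym   = IsEquivalence.sym (isEquivalence A)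
        ; trans = IsEquivalence.trans (isEquivalence A)
        }
    ; ⟦_⟧           = λ o xs → ⟦_⟧ A o (λ i → proj₁ (xs i))
                               , closed o (λ i → proj₁ (xs i)) (λ i → proj₂ (xs i))
    ; ⟦⟧-cong       = λ o ps → ⟦⟧-cong A o ps
    }

  record IsMLLattice {a} (A : Algebra a) (□ ◇ : Carrier A → Carrier A) : Set a where
    field
      isMLattice : IsMLattice (_≈_ A) (_∧_ A) (_∨_ A) □ ◇
      □-op       : ∀ {n} (o : Op n) (xs : Vector (Carrier A) n) →
                   _≈_ A (□ (⟦_⟧ A o (λ i → □ (xs i)))) (⟦_⟧ A o (λ i → □ (xs i)))

  IsClassOfLLattices : ∀ {a ℓ} → Pred (Algebra a) ℓ → Set (lsuc a ⊔ ℓ)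
  IsClassOfLLattices {a} K = ∀ (A : Algebra a) → A ∈ K → IsLLattice A

  ClosedUnderSubalgebras : ∀ {a ℓ} → Pred (Algebra a) ℓ → Set (lsuc a ⊔ ℓ)
  ClosedUnderSubalgebras {a} K =
    ∀ (A : Algebra a) (S : Pred (Carrier A) a) (closed : IsSubuniverse A S) →
    A ∈ K → Sub A S closed ∈ K

  ClosedUnderDirectPowers : ∀ {a ℓ} → Pred (Algebra a) ℓ → Set (lsuc a ⊔ ℓ)
  ClosedUnderDirectPowers {a} K = ∀ (A : Algebra a) (W : Set a) → A ∈ K → Pow A W ∈ K

  InMK : ∀ {a ℓ} → Pred (Algebra a) ℓ → (A : Algebra a) →
         (□ ◇ : Carrier A → Carrier A) → Set (a ⊔ ℓ)
  InMK K A □ ◇ = IsMLLattice A □ ◇ × A ∈ K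

  IsInfimum : ∀ {a} (A : Algebra a) {W : Set a} → (W → Carrier A) → Carrier A → Set a
  IsInfimum A f m = (∀ v → _≤_ A m (f v)) ×
                    (∀ l → (∀ v → _≤_ A l (f v)) → _≤_ A l m)

  IsSupremum : ∀ {a} (A : Algebra a) {W : Set a} → (W → Carrier A) → Carrier A → Set a
  IsSupremum A f m = (∀ v → _≤_ A (f v) m) ×
                     (∀ u → (∀ v → _≤_ A (f v) u) → _≤_ A m u)

  module BoxDiamond {a} (A : Algebra a) (W : Set a) (B : Pred (W → Carrier A) a)
    (inf : ∀ f → f ∈ B → Σ (Carrier A) (IsInfimum A f))
    (sup : ∀ f → f ∈ B → Σ (Carrier A) (IsSupremum A f))
    (□∈B : ∀ f (p : f ∈ B) → (λ (_ : W) → proj₁ (inf f p)) ∈ B)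
    (◇∈B : ∀ f (p : f ∈ B) → (λ (_ : W) → proj₁ (sup f p)) ∈ B) where

    □B : Σ (W → Carrier A) B → Σ (W → Carrier A) B
    □B (f , p) = (λ _ → proj₁ (inf f p)) , □∈B f p

    ◇B : Σ (W → Carrier A) B → Σ (W → Carrier A) B
    ◇B (f , p) = (λ _ → proj₁ (sup f p)) , ◇∈B f p

{-# OPTIONS --safe #-}
-- Equality in B is pointwise, so B is a lattice because A is, and ⋀, ⋁ inherit
-- ⋀(f ∧ g) = ⋀f ∧ ⋀g and ⋁(f ∨ g) = ⋁f ∨ ⋁g from the lattice order of A.
-- The remaining axioms rest on constant functions: □ and ◇ return constants,
-- the operations of B, being pointwise, preserve them, and □ and ◇ fix them,
-- since a constant family over a nonempty W has its value as infimum and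
-- supremum (a point of W is at hand whenever an equation in B is checked).
-- Membership in mK is closure of K under direct powers and subalgebras.
module Submission where

open import Defs
open import Level using (Level)
open import Function using (id)
open import Data.Product using (Σ; _×_; _,_; proj₁; proj₂)
open import Data.Fin using (zero; suc)
open import Data.Vec.Functional using (_∷_; [])
open import Relation.Unary using (Pred; _∈_)
open import Algebra.Lattice.Bundles using (Lattice)
open import Algebra.Lattice.Structures using (IsLattice)
import Algebra.Lattice.Properties.Lattice as LatticeProperties
import Relation.Binary.Lattice.Structures as OrderLattice
import Relation.Binary.Reasoning.Setoid as SetoidReasoning
open import Relation.Binary using (IsEquivalence; Setoid)
import Algebra.Definitions

module _ {𝓛 : Signature} where
  open Algebra using (Carrier)

  module LatticeOrder {a} (A : Algebra 𝓛 a) (L : IsLLattice 𝓛 A) where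
    open Algebra A using (_≈_; _∧_; _∨_; _≤_)
    open IsLattice L using (sym)

    -- The standard library orders a lattice by x ≈ x ∧ y, the mirror image of _≤_.
    private
      lattice : Lattice a a
      lattice = record { isLattice = L }

      module N = OrderLattice.IsLattice (LatticeProperties.∨-∧-isOrderTheoreticLattice lattice)

    ≤-refl : ∀ {x} → x ≤ x
    ≤-refl = sym N.refl

    ≤-trans : ∀ {x y z} → x ≤ y → y ≤ z → x ≤ z
    ≤-trans p q = sym (N.trans (sym p) (sym q))

    ≤-antisym : ∀ {x y} → x ≤ y → y ≤ x → x ≈ y
    ≤-antisym p q = N.antisym (sym p) (sym q)

    ≤-respʳ-≈ : ∀ {x y z} → y ≈ z → x ≤ y → x ≤ z
    ≤-respʳ-≈ y≈z p = sym (proj₁ N.≤-resp-≈ y≈z (sym p))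

    ≤-respˡ-≈ : ∀ {x y z} → x ≈ z → x ≤ y → z ≤ y
    ≤-respˡ-≈ x≈z p = sym (proj₂ N.≤-resp-≈ x≈z (sym p))

    x∧y≤x : ∀ x y → (x ∧ y) ≤ x
    x∧y≤x x y = sym (N.x∧y≤x x y)

    x∧y≤y : ∀ x y → (x ∧ y) ≤ y
    x∧y≤y x y = sym (N.x∧y≤y x y)

    ∧-greatest : ∀ {x y z} → x ≤ y → x ≤ z → x ≤ (y ∧ z)
    ∧-greatest p q = sym (N.∧-greatest (sym p) (sym q))

    x≤x∨y : ∀ x y → x ≤ (x ∨ y)
    x≤x∨y x y = sym (N.x≤x∨y x y)

    y≤x∨y : ∀ x y → y ≤ (x ∨ y)
    y≤x∨y x y = sym (N.y≤x∨y x y)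

    ∨-least : ∀ {x y z} → x ≤ z → y ≤ z → (x ∨ y) ≤ z
    ∨-least p q = sym (N.∨-least (sym p) (sym q))

    ≤⇒∨≈ʳ : ∀ {x y} → x ≤ y → (y ∨ x) ≈ y
    ≤⇒∨≈ʳ x≤y = ≤-antisym (∨-least ≤-refl x≤y) (x≤x∨y _ _)

    module _ {W : Set a} where

      infimum-cong : ∀ {f g : W → Carrier A} {m n} → (∀ v → f v ≈ g v) →
                     IsInfimum 𝓛 A f m → IsInfimum 𝓛 A g n → m ≈ n
      infimum-cong f≈g (m≤f , m-greatest) (n≤g , n-greatest) = ≤-antisym
        (n-greatest _ λ v → ≤-respʳ-≈ (f≈g v) (m≤f v))
        (m-greatest _ λ v → ≤-respʳ-≈ (sym (f≈g v)) (n≤g v))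

      supremum-cong : ∀ {f g : W → Carrier A} {m n} → (∀ v → f v ≈ g v) →
                      IsSupremum 𝓛 A f m → IsSupremum 𝓛 A g n → m ≈ n
      supremum-cong f≈g (f≤m , m-least) (g≤n , n-least) = ≤-antisym
        (m-least _ λ v → ≤-respˡ-≈ (sym (f≈g v)) (g≤n v))
        (n-least _ λ v → ≤-respˡ-≈ (f≈g v) (f≤m v))

      infimum-const : W → ∀ c → IsInfimum 𝓛 A (λ (_ : W) → c) c
      infimum-const w c = (λ _ → ≤-refl) , (λ _ l≤c → l≤c w)

      supremum-const : W → ∀ c → IsSupremum 𝓛 A (λ (_ : W) → c) c
      supremum-const w c = (λ _ → ≤-refl) , (λ _ c≤u → c≤u w)

      infimum-∧ : ∀ {f g : W → Carrier A} {m n} →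
                  IsInfimum 𝓛 A f m → IsInfimum 𝓛 A g n →
                  IsInfimum 𝓛 A (λ v → f v ∧ g v) (m ∧ n)
      infimum-∧ (m≤f , m-greatest) (n≤g , n-greatest) =
          (λ v → ∧-greatest (≤-trans (x∧y≤x _ _) (m≤f v)) (≤-trans (x∧y≤y _ _) (n≤g v)))
        , (λ l l≤f∧g → ∧-greatest
             (m-greatest l λ v → ≤-trans (l≤f∧g v) (x∧y≤x _ _))
             (n-greatest l λ v → ≤-trans (l≤f∧g v) (x∧y≤y _ _)))

      supremum-∨ : ∀ {f g : W → Carrier A} {m n} →
                   IsSupremum 𝓛 A f m → IsSupremum 𝓛 A g n →
                   IsSupremum 𝓛 A (λ v → f v ∨ g v) (m ∨ n)
      supremum-∨ (f≤m , m-least) (g≤n , n-least) =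
          (λ v → ∨-least (≤-trans (f≤m v) (x≤x∨y _ _)) (≤-trans (g≤n v) (y≤x∨y _ _)))
        , (λ u f∨g≤u → ∨-least
             (m-least u λ v → ≤-trans (x≤x∨y _ _) (f∨g≤u v))
             (n-least u λ v → ≤-trans (y≤x∨y _ _) (f∨g≤u v)))

  module JointEmbedding {a b i} (A : Algebra 𝓛 a) (B : Algebra 𝓛 b) {I : Set i}
    (h : I → Carrier B → Carrier A)
    (h-cong : ∀ {x y} → Algebra._≈_ B x y → ∀ k → Algebra._≈_ A (h k x) (h k y))
    (h-reflect : ∀ {x y} → (∀ k → Algebra._≈_ A (h k x) (h k y)) → Algebra._≈_ B x y)
    where
    open Algebra A using (_≈_)
    open Algebra B using () renaming (_≈_ to _≈ᴮ_)
    open IsEquivalence (Algebra.isEquivalence A)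
    open import Algebra.Definitions _≈_ using (Commutative; Associative; Congruent₂; _Absorbs_)
    module ᴮ = Algebra.Definitions _≈ᴮ_

    private
      setoidA : Setoid a a
      setoidA = record { isEquivalence = Algebra.isEquivalence A }

    module _ {_∙_ : Carrier B → Carrier B → Carrier B} {_∘_ : Carrier A → Carrier A → Carrier A}
      (h-∙ : ∀ k x y → h k (x ∙ y) ≈ (h k x ∘ h k y)) (∘-cong : Congruent₂ _∘_) where
      open SetoidReasoning setoidA

      comm-transfer : Commutative _∘_ → ᴮ.Commutative _∙_
      comm-transfer ∘-comm x y = h-reflect λ k → begin
        h k (x ∙ y)    ≈⟨ h-∙ k x y ⟩
        h k x ∘ h k y  ≈⟨ ∘-comm _ _ ⟩
        h k y ∘ h k x  ≈⟨ h-∙ k y x ⟨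
        h k (y ∙ x)    ∎

      assoc-transfer : Associative _∘_ → ᴮ.Associative _∙_
      assoc-transfer ∘-assoc x y z = h-reflect λ k → begin
        h k ((x ∙ y) ∙ z)        ≈⟨ h-∙ k _ z ⟩
        h k (x ∙ y) ∘ h k z      ≈⟨ ∘-cong (h-∙ k x y) refl ⟩
        (h k x ∘ h k y) ∘ h k z  ≈⟨ ∘-assoc _ _ _ ⟩
        h k x ∘ (h k y ∘ h k z)  ≈⟨ ∘-cong refl (h-∙ k y z) ⟨
        h k x ∘ h k (y ∙ z)      ≈⟨ h-∙ k x _ ⟨
        h k (x ∙ (y ∙ z))        ∎

      cong-transfer : ᴮ.Congruent₂ _∙_
      cong-transfer {x} {x′} {y} {y′} x≈x′ y≈y′ = h-reflect λ k → begin
        h k (x ∙ y)      ≈⟨ h-∙ k x y ⟩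
        h k x ∘ h k y    ≈⟨ ∘-cong (h-cong x≈x′ k) (h-cong y≈y′ k) ⟩
        h k x′ ∘ h k y′  ≈⟨ h-∙ k x′ y′ ⟨
        h k (x′ ∙ y′)    ∎

      absorbs-transfer : ∀ {_∙′_ _∘′_} → (∀ k x y → h k (x ∙′ y) ≈ (h k x ∘′ h k y)) →
                         _∘_ Absorbs _∘′_ → _∙_ ᴮ.Absorbs _∙′_
      absorbs-transfer {_∙′_} {_∘′_} h-∙′ ∘-absorbs-∘′ x y = h-reflect λ k → begin
        h k (x ∙ (x ∙′ y))          ≈⟨ h-∙ k x _ ⟩
        h k x ∘ h k (x ∙′ y)        ≈⟨ ∘-cong refl (h-∙′ k x y) ⟩
        h k x ∘ (h k x ∘′ h k y)    ≈⟨ ∘-absorbs-∘′ _ _ ⟩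
        h k x                       ∎

    isLLattice-transfer :
      (∀ k x y → h k (Algebra._∧_ B x y) ≈ Algebra._∧_ A (h k x) (h k y)) →
      (∀ k x y → h k (Algebra._∨_ B x y) ≈ Algebra._∨_ A (h k x) (h k y)) →
      IsLLattice 𝓛 A → IsLLattice 𝓛 B
    isLLattice-transfer h-∧ h-∨ L = record
      { isEquivalence = Algebra.isEquivalence B
      ; ∨-comm        = comm-transfer h-∨ ∨-cong ∨-comm
      ; ∨-assoc       = assoc-transfer h-∨ ∨-cong ∨-assoc
      ; ∨-cong        = cong-transfer h-∨ ∨-cong
      ; ∧-comm        = comm-transfer h-∧ ∧-cong ∧-comm
      ; ∧-assoc       = assoc-transfer h-∧ ∧-cong ∧-assoc
      ; ∧-cong        = cong-transfer h-∧ ∧-cong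
      ; absorptive    = absorbs-transfer h-∨ ∨-cong h-∧ ∨-absorbs-∧
                      , absorbs-transfer h-∧ ∧-cong h-∨ ∧-absorbs-∨
      }
      where open IsLattice L using (∨-comm; ∨-assoc; ∨-cong; ∧-comm; ∧-assoc; ∧-cong; ∨-absorbs-∧; ∧-absorbs-∨)

  module PowerSubalgebra {a} (A : Algebra 𝓛 a) (L : IsLLattice 𝓛 A)
    (W : Set a) (B : Pred (W → Carrier A) a)
    (B-sub : IsSubuniverse 𝓛 (Pow 𝓛 A W) B)
    (inf : ∀ f → f ∈ B → Σ (Carrier A) (IsInfimum 𝓛 A f))
    (sup : ∀ f → f ∈ B → Σ (Carrier A) (IsSupremum 𝓛 A f))
    (□∈B : ∀ f (p : f ∈ B) → (λ (_ : W) → proj₁ (inf f p)) ∈ B)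
    (◇∈B : ∀ f (p : f ∈ B) → (λ (_ : W) → proj₁ (sup f p)) ∈ B)
    where
    open Signature 𝓛 using (Op; meet; join)
    open Algebra A using (_≈_; _∧_; _∨_; ⟦_⟧; ⟦⟧-cong)
    open IsLattice L using (refl; sym; trans)
    open LatticeOrder A L
    open BoxDiamond 𝓛 A W B inf sup □∈B ◇∈B

    𝐁 : Algebra 𝓛 a
    𝐁 = Sub 𝓛 (Pow 𝓛 A W) B B-sub

    open Algebra 𝐁 using () renaming (_≈_ to _≈ᴮ_; _∧_ to _∧ᴮ_; _∨_ to _∨ᴮ_; ⟦_⟧ to ⟦_⟧ᴮ)

    _at_ : Carrier 𝐁 → W → Carrier A
    x at w = proj₁ x w

    ⟦⟧₂-at : ∀ (o : Op 2) x y w → (⟦ o ⟧ᴮ (x ∷ y ∷ []) at w) ≈ ⟦ o ⟧ (x at w ∷ y at w ∷ [])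
    ⟦⟧₂-at o x y w = ⟦⟧-cong o λ { zero → refl ; (suc zero) → refl }

    ∧-at : ∀ w x y → ((x ∧ᴮ y) at w) ≈ (x at w ∧ y at w)
    ∧-at w x y = ⟦⟧₂-at meet x y w

    ∨-at : ∀ w x y → ((x ∨ᴮ y) at w) ≈ (x at w ∨ y at w)
    ∨-at w x y = ⟦⟧₂-at join x y w

    isLLattice : IsLLattice 𝓛 𝐁
    isLLattice = JointEmbedding.isLLattice-transfer A 𝐁 (λ w x → x at w)
      id id ∧-at ∨-at L

    ⋀ ⋁ : Carrier 𝐁 → Carrier A
    ⋀ (f , f∈B) = proj₁ (inf f f∈B)
    ⋁ (f , f∈B) = proj₁ (sup f f∈B)

    ⋀-isInfimum : ∀ x → IsInfimum 𝓛 A (proj₁ x) (⋀ x)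
    ⋀-isInfimum (f , f∈B) = proj₂ (inf f f∈B)

    ⋁-isSupremum : ∀ x → IsSupremum 𝓛 A (proj₁ x) (⋁ x)
    ⋁-isSupremum (f , f∈B) = proj₂ (sup f f∈B)

    ⋀-∧ : ∀ x y → ⋀ (x ∧ᴮ y) ≈ (⋀ x ∧ ⋀ y)
    ⋀-∧ x y = infimum-cong (λ w → ∧-at w x y) (⋀-isInfimum (x ∧ᴮ y))
                (infimum-∧ (⋀-isInfimum x) (⋀-isInfimum y))

    ⋁-∨ : ∀ x y → ⋁ (x ∨ᴮ y) ≈ (⋁ x ∨ ⋁ y)
    ⋁-∨ x y = supremum-cong (λ w → ∨-at w x y) (⋁-isSupremum (x ∨ᴮ y))
                (supremum-∨ (⋁-isSupremum x) (⋁-isSupremum y))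

    IsConstant : Carrier 𝐁 → Set a
    IsConstant x = ∀ u v → (x at u) ≈ (x at v)

    □-constant : ∀ {x} → IsConstant x → □B x ≈ᴮ x
    □-constant {x} x-const w =
      infimum-cong (λ v → x-const v w) (⋀-isInfimum x) (infimum-const w (x at w))

    ◇-constant : ∀ {x} → IsConstant x → ◇B x ≈ᴮ x
    ◇-constant {x} x-const w =
      supremum-cong (λ v → x-const v w) (⋁-isSupremum x) (supremum-const w (x at w))

    isMLLattice : IsMLLattice 𝓛 𝐁 □B ◇B
    isMLLattice = record
      { isMLattice = record
        { isLattice = isLLattice
        ; □-cong    = λ {x} {y} x≈y _ → infimum-cong x≈y (⋀-isInfimum x) (⋀-isInfimum y)
        ; ◇-cong    = λ {x} {y} x≈y _ → supremum-cong x≈y (⋁-isSupremum x) (⋁-isSupremum y)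
        ; □-∧-x     = λ x w → trans (∧-at w (□B x) x) (proj₁ (⋀-isInfimum x) w)
        ; □-∧       = λ x y w → trans (⋀-∧ x y) (sym (∧-at w (□B x) (□B y)))
        ; □◇        = λ _ → □-constant (λ _ _ → refl)
        ; ◇-∨-x     = λ x w → trans (∨-at w (◇B x) x) (≤⇒∨≈ʳ (proj₁ (⋁-isSupremum x) w))
        ; ◇-∨       = λ x y w → trans (⋁-∨ x y) (sym (∨-at w (◇B x) (◇B y)))
        ; ◇□        = λ _ → ◇-constant (λ _ _ → refl)
        }
      ; □-op = λ _ _ → □-constant (λ _ _ → refl)
      }

proposition3p6 :
    ∀ {a ℓ : Level} (𝓛 : Signature) (A : Algebra 𝓛 a) → IsLLattice 𝓛 A →
    (W : Set a) (B : Pred (W → Algebra.Carrier A) a)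
    (B-sub : IsSubuniverse 𝓛 (Pow 𝓛 A W) B)
    (inf : ∀ f → f ∈ B → Σ (Algebra.Carrier A) (IsInfimum 𝓛 A f))
    (sup : ∀ f → f ∈ B → Σ (Algebra.Carrier A) (IsSupremum 𝓛 A f))
    (□∈B : ∀ f (p : f ∈ B) → (λ (_ : W) → proj₁ (inf f p)) ∈ B)
    (◇∈B : ∀ f (p : f ∈ B) → (λ (_ : W) → proj₁ (sup f p)) ∈ B) →
    IsMLLattice 𝓛 (Sub 𝓛 (Pow 𝓛 A W) B B-sub)
      (BoxDiamond.□B 𝓛 A W B inf sup □∈B ◇∈B)
      (BoxDiamond.◇B 𝓛 A W B inf sup □∈B ◇∈B)
    × (∀ (K : Pred (Algebra 𝓛 a) ℓ) → IsClassOfLLattices 𝓛 K →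
         ClosedUnderSubalgebras 𝓛 K → ClosedUnderDirectPowers 𝓛 K → A ∈ K →
         InMK 𝓛 K (Sub 𝓛 (Pow 𝓛 A W) B B-sub)
           (BoxDiamond.□B 𝓛 A W B inf sup □∈B ◇∈B)
           (BoxDiamond.◇B 𝓛 A W B inf sup □∈B ◇∈B))
proposition3p6 𝓛 A L W B B-sub inf sup □∈B ◇∈B =
  isMLLattice , λ K _ K-sub K-pow A∈K → isMLLattice , K-sub (Pow 𝓛 A W) B B-sub (K-pow A W A∈K)
  where open PowerSubalgebra A L W B B-sub inf sup □∈B ◇∈B
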